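{- For all integers $m,n\ge 0$, the Delannoy number $D(m,n)$ satisfies $D(m,n)=\binom{m,n}{n,2}$.
   Context: The Delannoy number $D(m,n)$ is the number of lattice paths from $(0,0)$ to $(m,n)$ using steps $(1,0)$, $(0,1)$ and $(1,1)$. For a nonnegative integer $m$ and positive integers $n,q$, let $X$ be a set which is the disjoint union of $n$ "main blocks" each of size $q$ and an "additional block" of size $m$. An $(n+k)$-inset of $X$ is an $(n+k)$-element subset of $X$ that intersects every main block; their number is denoted $\binom{m,n}{k,q}$ (for $n=0$ this is the ordinary binomial coefficient $\binom{m}{k}$). -}

module Defs where

open import Data.Nat using (ℕ; zero; suc; _+_; _≟_)
open import Data.Bool using (Bool; true; false; T)
open import Data.List using (List; []; _∷_; map; concatMap; filter; length; upTo; cartesianProduct)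
open import Data.Vec as V using (Vec; []; _∷_; count)
open import Data.Vec.Relation.Unary.All as VAll using (All)
open import Data.Vec.Relation.Unary.Any as VAny using (Any)
open import Data.Product using (_×_; _,_; proj₁; proj₂)
open import Relation.Binary.PropositionalEquality using (_≡_)
open import Relation.Nullary using (Dec)
open import Relation.Nullary.Decidable using (_×-dec_)
open import Data.Bool.Properties using (T?)

data Step : Set where
  E N NE : Step

stepVec : Step → ℕ × ℕ
stepVec E  = 1 , 0
stepVec N  = 0 , 1
stepVec NE = 1 , 1

endpoint : List Step → ℕ × ℕ
endpoint []       = 0 , 0
endpoint (s ∷ ws) = proj₁ (stepVec s) + proj₁ (endpoint ws)
                  , proj₂ (stepVec s) + proj₂ (endpoint ws)

allSteps : List Step
allSteps = E ∷ N ∷ NE ∷ []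

stepLists : ℕ → List (List Step)
stepLists zero    = [] ∷ []
stepLists (suc L) = concatMap (λ s → map (s ∷_) (stepLists L)) allSteps

stepListsUpTo : ℕ → List (List Step)
stepListsUpTo L = concatMap stepLists (upTo (suc L))

endsAt? : (m n : ℕ) (ws : List Step) → Dec (endpoint ws ≡ (m , n))
endsAt? m n ws with endpoint ws
... | a , b = Data.Product.Properties.≡-dec _≟_ _≟_ (a , b) (m , n)
  where import Data.Product.Properties

-- D(m,n) = number of lattice paths (0,0) → (m,n) with steps E, N, NE.
-- Every step increases x+y by at least 1, so all such paths have
-- length ≤ m + n and are enumerated by stepListsUpTo (m + n).
Delannoy : ℕ → ℕ → ℕ
Delannoy m n = length (filter (endsAt? m n) (stepListsUpTo (m + n)))

allSubsets : (r : ℕ) → List (Vec Bool r)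
allSubsets zero    = [] ∷ []
allSubsets (suc r) = concatMap (λ b → map (b ∷_) (allSubsets r)) (true ∷ false ∷ [])

allBlockSubsets : (n q : ℕ) → List (Vec (Vec Bool q) n)
allBlockSubsets zero    q = [] ∷ []
allBlockSubsets (suc n) q =
  concatMap (λ b → map (b ∷_) (allBlockSubsets n q)) (allSubsets q)

-- X = (additional block of size m) ⊔ (n main blocks of size q);
-- a subset of X is a pair (subset of additional block, subsets of each main block).
SubsetX : (m n q : ℕ) → Set
SubsetX m n q = Vec Bool m × Vec (Vec Bool q) n

allSubsetsX : (m n q : ℕ) → List (SubsetX m n q)
allSubsetsX m n q = cartesianProduct (allSubsets m) (allBlockSubsets n q)

size : ∀ {m n q} → SubsetX m n q → ℕ
size (a , bs) = count T? a + V.sum (V.map (count T?) bs)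

meetsAllMain : ∀ {m n q} → SubsetX m n q → Set
meetsAllMain (a , bs) = All (Any T) bs

meetsAllMain? : ∀ {m n q} (S : SubsetX m n q) → Dec (meetsAllMain S)
meetsAllMain? (a , bs) = VAll.all? (VAny.any? T?) bs

isInset? : ∀ {m n q} (k : ℕ) (S : SubsetX m n q) → Dec (meetsAllMain S × size S ≡ n + k)
isInset? {n = n} k S = meetsAllMain? S ×-dec (size S ≟ n + k)

-- binom (m,n ; k,q) : number of (n+k)-insets of X
insetBinom : (m n k q : ℕ) → ℕ
insetBinom m n k q = length (filter (isInset? k) (allSubsetsX m n q))

-- Sorting the subsets of X by size, a main block of size 2 contributes 2y + y² (it must be met,
-- by one of two singletons or by the whole block) and the additional block contributes (1 + y)^m,
-- so binom(m,n ; n,2) = [y^2n] (1 + y)^m (2y + y²)^n.  These diagonal coefficients satisfy the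
-- Delannoy recurrence D(m+1,n+1) = D(m,n+1) + D(m+1,n) + D(m,n) with D(0,n) = D(m,0) = 1, and so
-- does the number of lattice paths, by splitting off the first step.
module Submission where

open import Defs
open import Level using (0ℓ)
open import Function using (_∘_)
open import Data.Nat using (ℕ; zero; suc; _+_; _<_; _≤_; s≤s; z≤n; _≟_)
open import Data.Nat.Properties
  using (+-suc; +-assoc; +-comm; +-identityʳ; +-cancelˡ-≡; suc-injective;
         ≤-pred; ≤-refl; <-trans; n<1+n; <⇒≱; m≤m+n)
open import Data.Nat.ListAction using (sum)
open import Data.Nat.Tactic.RingSolver using (solve-∀)
open import Data.Bool using (Bool; true; false; T)
open import Data.Bool.Properties using (T?)
open import Data.Unit using (tt)
open import Data.Product using (_×_; _,_; proj₁; proj₂; map₁)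
open import Data.Product.Properties using (×-≡,≡→≡; ,-injectiveˡ; ,-injectiveʳ)
open import Data.Sum using (_⊎_; inj₁; inj₂; [_,_])
open import Data.List
  using (List; []; _∷_; _++_; map; concatMap; filter; length; applyUpTo; upTo; cartesianProduct)
open import Data.List.Properties
  using (filter-++; filter-≐; filter-none; length-++; map-∘; map-cong; map-upTo; ++-identityʳ;
         cartesianProductWith-distribʳ-++)
open import Data.List.Relation.Unary.All as All using ()
open import Data.Vec as V using (Vec)
open import Data.Vec.Relation.Unary.All using () renaming (_∷_ to _∷ᴬ_)
open import Data.Vec.Relation.Unary.Any using (Any; here; there)
open import Relation.Binary.PropositionalEquality
  using (_≡_; refl; sym; trans; cong; cong₂; subst; module ≡-Reasoning)
open import Relation.Nullary using (does; ¬_)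
open import Relation.Nullary.Decidable using (_×-dec_)
open import Relation.Unary using (Pred; Decidable; _≐_)

open ≡-Reasoning

count : ∀ {A : Set} {P : Pred A 0ℓ} → Decidable P → List A → ℕ
count P? xs = length (filter P? xs)

module _ {A : Set} {P : Pred A 0ℓ} (P? : Decidable P) where

  count-++ : ∀ xs ys → count P? (xs ++ ys) ≡ count P? xs + count P? ys
  count-++ xs ys = trans (cong length (filter-++ P? xs ys)) (length-++ (filter P? xs))

  count-none : (∀ x → ¬ P x) → ∀ xs → count P? xs ≡ 0
  count-none ¬P xs = cong length (filter-none P? (All.universal ¬P xs))

  count-concatMap : ∀ {B : Set} (f : B → List A) xs → count P? (concatMap f xs) ≡ sum (map (count P? ∘ f) xs)
  count-concatMap f []       = refl
  count-concatMap f (x ∷ xs) = trans (count-++ (f x) _) (cong (count P? (f x) +_) (count-concatMap f xs))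

count-≐ : ∀ {A : Set} {P Q : Pred A 0ℓ} (P? : Decidable P) (Q? : Decidable Q) →
          P ≐ Q → ∀ xs → count P? xs ≡ count Q? xs
count-≐ P? Q? P≐Q xs = cong length (filter-≐ P? Q? P≐Q xs)

count-map : ∀ {A B : Set} {P : Pred B 0ℓ} (P? : Decidable P) (f : A → B) xs →
            count P? (map f xs) ≡ count (P? ∘ f) xs
count-map P? f []       = refl
count-map P? f (x ∷ xs) with does (P? (f x))
... | true  = cong suc (count-map P? f xs)
... | false = count-map P? f xs

count-concatMap-map : ∀ {A B C : Set} {P : Pred C 0ℓ} (P? : Decidable P) (g : A → B → C) xs ys →
                      count P? (concatMap (λ x → map (g x) ys) xs) ≡ sum (map (λ x → count (P? ∘ g x) ys) xs)
count-concatMap-map P? g xs ys =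
  trans (count-concatMap P? (λ x → map (g x) ys) xs) (cong sum (map-cong (λ x → count-map P? (g x) ys) xs))

count-cartesianProduct : ∀ {A B : Set} {P : Pred (A × B) 0ℓ} (P? : Decidable P) xs ys →
                         count P? (cartesianProduct xs ys) ≡ sum (map (λ x → count (P? ∘ (x ,_)) ys) xs)
count-cartesianProduct P? []       ys = refl
count-cartesianProduct P? (x ∷ xs) ys =
  trans (count-++ P? (map (x ,_) ys) _) (cong₂ _+_ (count-map P? (x ,_) ys) (count-cartesianProduct P? xs ys))

count-cartesianProduct-mapˡ :
  ∀ {A A′ B : Set} {P : Pred (A′ × B) 0ℓ} (P? : Decidable P) (f : A → A′) xs ys →
  count P? (cartesianProduct (map f xs) ys) ≡ count (P? ∘ map₁ f) (cartesianProduct xs ys)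
count-cartesianProduct-mapˡ P? f xs ys = begin
  count P? (cartesianProduct (map f xs) ys)              ≡⟨ count-cartesianProduct P? (map f xs) ys ⟩
  sum (map (λ x′ → count (P? ∘ (x′ ,_)) ys) (map f xs))  ≡⟨ cong sum (sym (map-∘ xs)) ⟩
  sum (map (λ x → count (P? ∘ (f x ,_)) ys) xs)          ≡⟨ sym (count-cartesianProduct (P? ∘ map₁ f) xs ys) ⟩
  count (P? ∘ map₁ f) (cartesianProduct xs ys)           ∎

count-cartesianProduct-allSubsets-suc :
  ∀ {B : Set} {m} {P : Pred (Vec Bool (suc m) × B) 0ℓ} (P? : Decidable P) ys →
  count P? (cartesianProduct (allSubsets (suc m)) ys)
    ≡ count (P? ∘ map₁ (true V.∷_)) (cartesianProduct (allSubsets m) ys)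
      + count (P? ∘ map₁ (false V.∷_)) (cartesianProduct (allSubsets m) ys)
count-cartesianProduct-allSubsets-suc {m = m} P? ys = begin
  count P? (cartesianProduct (withTrue ++ (withFalse ++ [])) ys)
    ≡⟨ cong (λ zs → count P? (cartesianProduct (withTrue ++ zs) ys)) (++-identityʳ withFalse) ⟩
  count P? (cartesianProduct (withTrue ++ withFalse) ys)
    ≡⟨ cong (count P?) (cartesianProductWith-distribʳ-++ _,_ withTrue withFalse ys) ⟩
  count P? (cartesianProduct withTrue ys ++ cartesianProduct withFalse ys)
    ≡⟨ count-++ P? (cartesianProduct withTrue ys) _ ⟩
  count P? (cartesianProduct withTrue ys) + count P? (cartesianProduct withFalse ys)
    ≡⟨ cong₂ _+_ (count-cartesianProduct-mapˡ P? (true V.∷_) A ys)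
                 (count-cartesianProduct-mapˡ P? (false V.∷_) A ys) ⟩
  count (P? ∘ map₁ (true V.∷_)) (cartesianProduct A ys) + count (P? ∘ map₁ (false V.∷_)) (cartesianProduct A ys) ∎
  where
  A = allSubsets m
  withTrue withFalse : List (Vec Bool (suc m))
  withTrue  = map (true V.∷_) A
  withFalse = map (false V.∷_) A

sum-applyUpTo-cong : ∀ {f g : ℕ → ℕ} → (∀ i → f i ≡ g i) → ∀ K → sum (applyUpTo f K) ≡ sum (applyUpTo g K)
sum-applyUpTo-cong f≗g zero    = refl
sum-applyUpTo-cong f≗g (suc K) = cong₂ _+_ (f≗g 0) (sum-applyUpTo-cong (f≗g ∘ suc) K)

sum-applyUpTo-zero : ∀ {f : ℕ → ℕ} → (∀ i → f i ≡ 0) → ∀ K → sum (applyUpTo f K) ≡ 0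
sum-applyUpTo-zero f≗0 zero    = refl
sum-applyUpTo-zero f≗0 (suc K) = cong₂ _+_ (f≗0 0) (sum-applyUpTo-zero (f≗0 ∘ suc) K)

sum-applyUpTo-+ : ∀ (f g : ℕ → ℕ) K →
                  sum (applyUpTo (λ i → f i + g i) K) ≡ sum (applyUpTo f K) + sum (applyUpTo g K)
sum-applyUpTo-+ f g zero    = refl
sum-applyUpTo-+ f g (suc K) =
  trans (cong (f 0 + g 0 +_) (sum-applyUpTo-+ (f ∘ suc) (g ∘ suc) K)) (interchange (f 0) (g 0) _ _)
  where
  interchange : ∀ a b c d → a + b + (c + d) ≡ a + c + (b + d)
  interchange = solve-∀

delannoyRec : ℕ → ℕ → ℕ
delannoyRec zero    n       = 1
delannoyRec (suc m) zero    = 1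
delannoyRec (suc m) (suc n) = delannoyRec m (suc n) + (delannoyRec (suc m) n + delannoyRec m n)

delannoyRec-zeroʳ : ∀ m → delannoyRec m 0 ≡ 1
delannoyRec-zeroʳ zero    = refl
delannoyRec-zeroʳ (suc m) = refl

-- endpoint (s ∷ ws) is definitionally stepVec s ⊕ endpoint ws.
_⊕_ : ℕ × ℕ → ℕ × ℕ → ℕ × ℕ
u ⊕ v = proj₁ u + proj₁ v , proj₂ u + proj₂ v

⊕-cancelˡ : ∀ u {v w} → u ⊕ v ≡ u ⊕ w → v ≡ w
⊕-cancelˡ u e =
  ×-≡,≡→≡ (+-cancelˡ-≡ (proj₁ u) _ _ (,-injectiveˡ e) , +-cancelˡ-≡ (proj₂ u) _ _ (,-injectiveʳ e))

pathsOfLength : (L m n : ℕ) → ℕ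
pathsOfLength L m n = count (endsAt? m n) (stepLists L)

pathsStartingWith : Step → (L m n : ℕ) → ℕ
pathsStartingWith s L m n = count (endsAt? m n ∘ (s ∷_)) (stepLists L)

pathsOfLength-suc : ∀ L m n →
  pathsOfLength (suc L) m n
    ≡ pathsStartingWith E L m n + (pathsStartingWith N L m n + pathsStartingWith NE L m n)
pathsOfLength-suc L m n =
  trans (count-concatMap-map (endsAt? m n) _∷_ allSteps (stepLists L))
        (cong (λ k → pathsStartingWith E L m n + (pathsStartingWith N L m n + k)) (+-identityʳ _))

pathsStartingWith-shift : ∀ s L m n →
  pathsStartingWith s L (proj₁ (stepVec s) + m) (proj₂ (stepVec s) + n) ≡ pathsOfLength L m n
pathsStartingWith-shift s L m n =
  count-≐ _ (endsAt? m n) (⊕-cancelˡ (stepVec s) , cong (stepVec s ⊕_)) (stepLists L)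

pathsStartingWith-blocked : ∀ s L m n →
  m < proj₁ (stepVec s) ⊎ n < proj₂ (stepVec s) → pathsStartingWith s L m n ≡ 0
pathsStartingWith-blocked s L m n overshoots = count-none (endsAt? m n ∘ (s ∷_)) unreachable (stepLists L)
  where
  unreachable : ∀ ws → ¬ (stepVec s ⊕ endpoint ws ≡ (m , n))
  unreachable ws e =
    [ (λ m<dx → <⇒≱ m<dx (subst (_ ≤_) (,-injectiveˡ e) (m≤m+n _ _)))
    , (λ n<dy → <⇒≱ n<dy (subst (_ ≤_) (,-injectiveʳ e) (m≤m+n _ _)))
    ] overshoots

pathsOfLength-suc-origin : ∀ L → pathsOfLength (suc L) 0 0 ≡ 0
pathsOfLength-suc-origin L = trans (pathsOfLength-suc L 0 0)
  (cong₂ _+_ (pathsStartingWith-blocked E L 0 0 (inj₁ (s≤s z≤n)))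
             (cong₂ _+_ (pathsStartingWith-blocked N L 0 0 (inj₂ (s≤s z≤n)))
                        (pathsStartingWith-blocked NE L 0 0 (inj₁ (s≤s z≤n)))))

pathsOfLength-suc-axisˣ : ∀ L m → pathsOfLength (suc L) (suc m) 0 ≡ pathsOfLength L m 0
pathsOfLength-suc-axisˣ L m = trans (pathsOfLength-suc L (suc m) 0)
  (trans (cong₂ _+_ (pathsStartingWith-shift E L m 0)
                    (cong₂ _+_ (pathsStartingWith-blocked N L (suc m) 0 (inj₂ (s≤s z≤n)))
                               (pathsStartingWith-blocked NE L (suc m) 0 (inj₂ (s≤s z≤n)))))
         (+-identityʳ _))

pathsOfLength-suc-axisʸ : ∀ L n → pathsOfLength (suc L) 0 (suc n) ≡ pathsOfLength L 0 n
pathsOfLength-suc-axisʸ L n = trans (pathsOfLength-suc L 0 (suc n))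
  (cong₂ _+_ (pathsStartingWith-blocked E L 0 (suc n) (inj₁ (s≤s z≤n)))
             (trans (cong₂ _+_ (pathsStartingWith-shift N L 0 n)
                               (pathsStartingWith-blocked NE L 0 (suc n) (inj₁ (s≤s z≤n))))
                    (+-identityʳ _)))

pathsOfLength-suc-interior : ∀ L m n →
  pathsOfLength (suc L) (suc m) (suc n)
    ≡ pathsOfLength L m (suc n) + (pathsOfLength L (suc m) n + pathsOfLength L m n)
pathsOfLength-suc-interior L m n = trans (pathsOfLength-suc L (suc m) (suc n))
  (cong₂ _+_ (pathsStartingWith-shift E L m (suc n))
             (cong₂ _+_ (pathsStartingWith-shift N L (suc m) n) (pathsStartingWith-shift NE L m n)))

pathsShorterThan : (K m n : ℕ) → ℕ
pathsShorterThan K m n = sum (applyUpTo (λ L → pathsOfLength L m n) K)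

pathsShorterThan≡delannoyRec : ∀ K m n → m + n < K → pathsShorterThan K m n ≡ delannoyRec m n
pathsShorterThan≡delannoyRec (suc K) zero zero _ =
  cong suc (sum-applyUpTo-zero pathsOfLength-suc-origin K)
pathsShorterThan≡delannoyRec (suc K) (suc m) zero m+n<K+1 =
  trans (sum-applyUpTo-cong (λ L → pathsOfLength-suc-axisˣ L m) K)
        (trans (pathsShorterThan≡delannoyRec K m 0 (≤-pred m+n<K+1)) (delannoyRec-zeroʳ m))
pathsShorterThan≡delannoyRec (suc K) zero (suc n) m+n<K+1 =
  trans (sum-applyUpTo-cong (λ L → pathsOfLength-suc-axisʸ L n) K)
        (pathsShorterThan≡delannoyRec K 0 n (≤-pred m+n<K+1))
pathsShorterThan≡delannoyRec (suc K) (suc m) (suc n) m+n<K+1 = begin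
  sum (applyUpTo (λ L → pathsOfLength (suc L) (suc m) (suc n)) K)
    ≡⟨ sum-applyUpTo-cong (λ L → pathsOfLength-suc-interior L m n) K ⟩
  sum (applyUpTo (λ L → pathsOfLength L m (suc n) + (pathsOfLength L (suc m) n + pathsOfLength L m n)) K)
    ≡⟨ sum-applyUpTo-+ (λ L → pathsOfLength L m (suc n)) _ K ⟩
  pathsShorterThan K m (suc n) + sum (applyUpTo (λ L → pathsOfLength L (suc m) n + pathsOfLength L m n) K)
    ≡⟨ cong (pathsShorterThan K m (suc n) +_) (sum-applyUpTo-+ (λ L → pathsOfLength L (suc m) n) _ K) ⟩
  pathsShorterThan K m (suc n) + (pathsShorterThan K (suc m) n + pathsShorterThan K m n)
    ≡⟨ cong₂ _+_ (pathsShorterThan≡delannoyRec K m (suc n) m+n+1<K)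
                 (cong₂ _+_ (pathsShorterThan≡delannoyRec K (suc m) n m+1+n<K)
                            (pathsShorterThan≡delannoyRec K m n m+n<K)) ⟩
  delannoyRec (suc m) (suc n) ∎
  where
  m+n+1<K : m + suc n < K
  m+n+1<K = ≤-pred m+n<K+1
  m+1+n<K : suc m + n < K
  m+1+n<K = subst (_< K) (+-suc m n) m+n+1<K
  m+n<K : m + n < K
  m+n<K = <-trans (n<1+n (m + n)) m+1+n<K

Delannoy≡delannoyRec : ∀ m n → Delannoy m n ≡ delannoyRec m n
Delannoy≡delannoyRec m n = begin
  Delannoy m n                                    ≡⟨ count-concatMap (endsAt? m n) stepLists (upTo K) ⟩
  sum (map (λ L → pathsOfLength L m n) (upTo K))  ≡⟨ cong sum (map-upTo (λ L → pathsOfLength L m n) K) ⟩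
  pathsShorterThan K m n                          ≡⟨ pathsShorterThan≡delannoyRec K m n ≤-refl ⟩
  delannoyRec m n                                 ∎
  where K = suc (m + n)

-- mainCoeff n s = [y^s] (2y + y²)^n  and  coeff m n s = [y^s] (1 + y)^m (2y + y²)^n.
mainCoeff : ℕ → ℕ → ℕ
mainCoeff zero    zero          = 1
mainCoeff zero    (suc s)       = 0
mainCoeff (suc n) zero          = 0
mainCoeff (suc n) (suc zero)    = mainCoeff n 0 + mainCoeff n 0
mainCoeff (suc n) (suc (suc s)) = mainCoeff n s + (mainCoeff n (suc s) + mainCoeff n (suc s))

coeff : ℕ → ℕ → ℕ → ℕ
coeff zero    n s       = mainCoeff n s
coeff (suc m) n zero    = coeff m n zero
coeff (suc m) n (suc s) = coeff m n s + coeff m n (suc s)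

mainCoeff-aboveDegree : ∀ n s → n + n < s → mainCoeff n s ≡ 0
mainCoeff-aboveDegree zero    (suc s)       _ = refl
mainCoeff-aboveDegree (suc n) zero          _ = refl
mainCoeff-aboveDegree (suc n) (suc zero)    (s≤s ())
mainCoeff-aboveDegree (suc n) (suc (suc s)) 2n+2<s+2 =
  cong₂ _+_ (mainCoeff-aboveDegree n s 2n<s)
            (cong₂ _+_ (mainCoeff-aboveDegree n (suc s) 2n<s+1) (mainCoeff-aboveDegree n (suc s) 2n<s+1))
  where
  2n<s : n + n < s
  2n<s = subst (_≤ s) (+-suc n n) (≤-pred (≤-pred 2n+2<s+2))
  2n<s+1 : n + n < suc s
  2n<s+1 = <-trans 2n<s (n<1+n s)

mainCoeff-leading : ∀ n → mainCoeff n (n + n) ≡ 1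
mainCoeff-leading zero    = refl
mainCoeff-leading (suc n)
  rewrite +-suc n n | mainCoeff-leading n | mainCoeff-aboveDegree n (suc (n + n)) ≤-refl = refl

coeff-zero-zero : ∀ m → coeff m 0 0 ≡ 1
coeff-zero-zero zero    = refl
coeff-zero-zero (suc m) = coeff-zero-zero m

coeff-sucₙ-zero : ∀ m n → coeff m (suc n) 0 ≡ 0
coeff-sucₙ-zero zero    n = refl
coeff-sucₙ-zero (suc m) n = coeff-sucₙ-zero m n

coeff-sucₙ-one : ∀ m n → coeff m (suc n) 1 ≡ coeff m n 0 + coeff m n 0
coeff-sucₙ-one zero    n = refl
coeff-sucₙ-one (suc m) n rewrite coeff-sucₙ-zero m n | coeff-sucₙ-one m n = refl

coeff-sucₙ-suc-suc : ∀ m n s →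
  coeff m (suc n) (suc (suc s)) ≡ coeff m n s + (coeff m n (suc s) + coeff m n (suc s))
coeff-sucₙ-suc-suc zero    n s = refl
coeff-sucₙ-suc-suc (suc m) n zero
  rewrite coeff-sucₙ-one m n | coeff-sucₙ-suc-suc m n zero = shuffle (coeff m n 0) (coeff m n 1)
  where
  shuffle : ∀ a b → a + a + (a + (b + b)) ≡ a + (a + b + (a + b))
  shuffle = solve-∀
coeff-sucₙ-suc-suc (suc m) n (suc s)
  rewrite coeff-sucₙ-suc-suc m n s | coeff-sucₙ-suc-suc m n (suc s) =
  shuffle (coeff m n s) (coeff m n (suc s)) (coeff m n (suc (suc s)))
  where
  shuffle : ∀ a b c → a + (b + b) + (b + (c + c)) ≡ a + b + (b + c + (b + c))
  shuffle = solve-∀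

coeff-sucₙ-odd : ∀ m n → coeff m (suc n) (suc (n + n)) ≡ coeff (suc m) n (n + n) + coeff m n (n + n)
coeff-sucₙ-odd m zero    = coeff-sucₙ-one m 0
coeff-sucₙ-odd m (suc n) rewrite +-suc n n | coeff-sucₙ-suc-suc m (suc n) (suc (n + n)) =
  sym (+-assoc (coeff m (suc n) (suc (n + n))) _ _)

delannoyRec≡coeff : ∀ m n → delannoyRec m n ≡ coeff m n (n + n)
delannoyRec≡coeff zero    n       = sym (mainCoeff-leading n)
delannoyRec≡coeff (suc m) zero    = sym (coeff-zero-zero m)
delannoyRec≡coeff (suc m) (suc n) = begin
  delannoyRec m (suc n) + (delannoyRec (suc m) n + delannoyRec m n)
    ≡⟨ cong₂ _+_ (delannoyRec≡coeff m (suc n))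
                 (cong₂ _+_ (delannoyRec≡coeff (suc m) n) (delannoyRec≡coeff m n)) ⟩
  coeff m (suc n) (suc n + suc n) + (coeff (suc m) n (n + n) + coeff m n (n + n))
    ≡⟨ +-comm (coeff m (suc n) (suc n + suc n)) _ ⟩
  coeff (suc m) n (n + n) + coeff m n (n + n) + coeff m (suc n) (suc n + suc n)
    ≡⟨ cong₂ _+_ (sym (coeff-sucₙ-odd m n)) (cong (coeff m (suc n)) 2n+2≡) ⟩
  coeff (suc m) (suc n) (suc (suc (n + n)))
    ≡⟨ cong (coeff (suc m) (suc n)) (sym 2n+2≡) ⟩
  coeff (suc m) (suc n) (suc n + suc n) ∎
  where
  2n+2≡ : suc n + suc n ≡ suc (suc (n + n))
  2n+2≡ = cong suc (+-suc n n)

SizedInset : ∀ {m n q} → ℕ → SubsetX m n q → Set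
SizedInset s S = meetsAllMain S × size S ≡ s

sizedInset? : ∀ {m n q} s → Decidable (SizedInset {m} {n} {q} s)
sizedInset? s S = meetsAllMain? S ×-dec (size S ≟ s)

insetCount : (m n q s : ℕ) → ℕ
insetCount m n q s = count (sizedInset? s) (allSubsetsX m n q)

insetCount-suc-zero : ∀ m n q → insetCount (suc m) n q 0 ≡ insetCount m n q 0
insetCount-suc-zero m n q =
  trans (count-cartesianProduct-allSubsets-suc {m = m} (sizedInset? 0) (allBlockSubsets n q))
        (cong (_+ insetCount m n q 0) (count-none _ (λ { _ (_ , ()) }) (allSubsetsX m n q)))

insetCount-suc-suc : ∀ m n q s → insetCount (suc m) n q (suc s) ≡ insetCount m n q s + insetCount m n q (suc s)
insetCount-suc-suc m n q s =
  trans (count-cartesianProduct-allSubsets-suc {m = m} (sizedInset? (suc s)) (allBlockSubsets n q))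
        (cong (_+ insetCount m n q (suc s)) (count-≐ _ (sizedInset? s) shrink (allSubsetsX m n q)))
  where
  shrink : SizedInset (suc s) ∘ map₁ (true V.∷_) ≐ SizedInset s
  shrink = (λ (meets , e) → meets , suc-injective e) , (λ (meets , e) → meets , cong suc e)

mainInsetCount : (n q s : ℕ) → ℕ
mainInsetCount n q s = count (λ bs → sizedInset? {0} {n} {q} s (V.[] , bs)) (allBlockSubsets n q)

insetCount-zero : ∀ n q s → insetCount 0 n q s ≡ mainInsetCount n q s
insetCount-zero n q s =
  trans (count-cartesianProduct (sizedInset? s) (allSubsets 0) (allBlockSubsets n q)) (+-identityʳ _)

insetsWithFirstBlock : ∀ {q} → Vec Bool q → (n s : ℕ) → ℕ
insetsWithFirstBlock {q} b n s =
  count (λ bs → sizedInset? {0} {suc n} {q} s (V.[] , b V.∷ bs)) (allBlockSubsets n q)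

module _ {q} (b : Vec Bool q) (n : ℕ) where

  insetsWithFirstBlock-unmet : ¬ Any T b → ∀ s → insetsWithFirstBlock b n s ≡ 0
  insetsWithFirstBlock-unmet ¬met s = count-none _ (λ { _ ((met ∷ᴬ _) , _) → ¬met met }) (allBlockSubsets n q)

  insetsWithFirstBlock-tooSmall : ∀ s → s < V.count T? b → insetsWithFirstBlock b n s ≡ 0
  insetsWithFirstBlock-tooSmall s s<|b| = count-none _ tooSmall (allBlockSubsets n q)
    where
    tooSmall : ∀ bs → ¬ SizedInset s (V.[] , b V.∷ bs)
    tooSmall bs (_ , e) = <⇒≱ s<|b| (subst (V.count T? b ≤_) e (m≤m+n _ _))

  insetsWithFirstBlock-met : Any T b → ∀ s → insetsWithFirstBlock b n (V.count T? b + s) ≡ mainInsetCount n q s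
  insetsWithFirstBlock-met met s = count-≐ _ (λ bs → sizedInset? {0} {n} {q} s (V.[] , bs))
    ( (λ { ((_ ∷ᴬ meets) , e) → meets , +-cancelˡ-≡ (V.count T? b) _ _ e })
    , (λ (meets , e) → (met ∷ᴬ meets) , cong (V.count T? b +_) e) )
    (allBlockSubsets n q)

full singleˡ singleʳ empty : Vec Bool 2
full    = true  V.∷ true  V.∷ V.[]
singleˡ = true  V.∷ false V.∷ V.[]
singleʳ = false V.∷ true  V.∷ V.[]
empty   = false V.∷ false V.∷ V.[]

mainInsetCount-suc : ∀ n s →
  mainInsetCount (suc n) 2 s
    ≡ insetsWithFirstBlock full n s + (insetsWithFirstBlock singleˡ n s + insetsWithFirstBlock singleʳ n s)
mainInsetCount-suc n s =
  trans (count-concatMap-map (λ bs → sizedInset? {0} {suc n} {2} s (V.[] , bs)) V._∷_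
                             (allSubsets 2) (allBlockSubsets n 2))
        (cong (λ k → insetsWithFirstBlock full n s + (insetsWithFirstBlock singleˡ n s + k))
              (trans (cong (insetsWithFirstBlock singleʳ n s +_)
                           (trans (+-identityʳ _) (insetsWithFirstBlock-unmet empty n emptyUnmet s)))
                     (+-identityʳ _)))
  where
  emptyUnmet : ¬ Any T empty
  emptyUnmet (there (here ()))
  emptyUnmet (there (there ()))

mainInsetCount-suc-zero : ∀ n → mainInsetCount (suc n) 2 0 ≡ 0
mainInsetCount-suc-zero n = trans (mainInsetCount-suc n 0)
  (cong₂ _+_ (insetsWithFirstBlock-tooSmall full n 0 (s≤s z≤n))
             (cong₂ _+_ (insetsWithFirstBlock-tooSmall singleˡ n 0 (s≤s z≤n))
                        (insetsWithFirstBlock-tooSmall singleʳ n 0 (s≤s z≤n))))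

mainInsetCount-suc-one : ∀ n → mainInsetCount (suc n) 2 1 ≡ mainInsetCount n 2 0 + mainInsetCount n 2 0
mainInsetCount-suc-one n = trans (mainInsetCount-suc n 1)
  (cong₂ _+_ (insetsWithFirstBlock-tooSmall full n 1 (s≤s (s≤s z≤n)))
             (cong₂ _+_ (insetsWithFirstBlock-met singleˡ n (here tt) 0)
                        (insetsWithFirstBlock-met singleʳ n (there (here tt)) 0)))

mainInsetCount-suc-suc : ∀ n s →
  mainInsetCount (suc n) 2 (suc (suc s))
    ≡ mainInsetCount n 2 s + (mainInsetCount n 2 (suc s) + mainInsetCount n 2 (suc s))
mainInsetCount-suc-suc n s = trans (mainInsetCount-suc n (suc (suc s)))
  (cong₂ _+_ (insetsWithFirstBlock-met full n (here tt) s)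
             (cong₂ _+_ (insetsWithFirstBlock-met singleˡ n (here tt) (suc s))
                        (insetsWithFirstBlock-met singleʳ n (there (here tt)) (suc s))))

mainInsetCount≡mainCoeff : ∀ n s → mainInsetCount n 2 s ≡ mainCoeff n s
mainInsetCount≡mainCoeff zero    zero          = refl
mainInsetCount≡mainCoeff zero    (suc s)       = refl
mainInsetCount≡mainCoeff (suc n) zero          = mainInsetCount-suc-zero n
mainInsetCount≡mainCoeff (suc n) (suc zero)    =
  trans (mainInsetCount-suc-one n) (cong₂ _+_ (mainInsetCount≡mainCoeff n 0) (mainInsetCount≡mainCoeff n 0))
mainInsetCount≡mainCoeff (suc n) (suc (suc s)) =
  trans (mainInsetCount-suc-suc n s)
        (cong₂ _+_ (mainInsetCount≡mainCoeff n s)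
                   (cong₂ _+_ (mainInsetCount≡mainCoeff n (suc s)) (mainInsetCount≡mainCoeff n (suc s))))

insetCount≡coeff : ∀ m n s → insetCount m n 2 s ≡ coeff m n s
insetCount≡coeff zero    n s       = trans (insetCount-zero n 2 s) (mainInsetCount≡mainCoeff n s)
insetCount≡coeff (suc m) n zero    = trans (insetCount-suc-zero m n 2) (insetCount≡coeff m n 0)
insetCount≡coeff (suc m) n (suc s) =
  trans (insetCount-suc-suc m n 2 s) (cong₂ _+_ (insetCount≡coeff m n s) (insetCount≡coeff m n (suc s)))

mainTheorem9 : (m n : ℕ) → Delannoy m n ≡ insetBinom m n n 2
mainTheorem9 m n = begin
  Delannoy m n              ≡⟨ Delannoy≡delannoyRec m n ⟩
  delannoyRec m n           ≡⟨ delannoyRec≡coeff m n ⟩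
  coeff m n (n + n)         ≡⟨ sym (insetCount≡coeff m n (n + n)) ⟩
  insetCount m n 2 (n + n)  ≡⟨⟩
  insetBinom m n n 2        ∎
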